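{- Let $G$ be a digraph on vertex set $V=[n]$ and let $G_\ell$ be a digraph on $V$ with $E(G)\subseteq E(G_\ell)$. Let $A\in\mathcal M(G)$ and let $X$ be a real $n\times n$ matrix with $AX^\top-X^\top A=O$ and $A_\ell\circ X=O$ for all $A_\ell\in\mathcal M(G_\ell)$. (A) If for some $i,j,k\in V$ we have $N^+_G[i]\cap (V\setminus N^+_{G_\ell}[j])=\{k\}$ and $N^-_G[j]\cap(V\setminus N^-_{G_\ell}[i])=\emptyset$, then $X\circ A_{\ell+1}=O$ for all $A_{\ell+1}\in\mathcal M(G_{\ell+1})$, where $G_{\ell+1}$ is $G_\ell$ with the arc $(j,k)$ added. (B) If for some $i,j,m\in V$ we have $N^+_G[i]\cap(V\setminus N^+_{G_\ell}[j])=\emptyset$ and $N^-_G[j]\cap(V\setminus N^-_{G_\ell}[i])=\{m\}$, then $X\circ A_{\ell+1}=O$ for all $A_{\ell+1}\in\mathcal M(G_{\ell+1})$, where $G_{\ell+1}$ is $G_\ell$ with the arc $(m,i)$ added.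
   Context: A digraph $G$ has vertex set $[n]$ and arc set $E(G)\subseteq[n]\times[n]$ (arcs $(v,v)$ are loops). $\mathcal M(G)$ is the set of real $n\times n$ matrices $A=(a_{ij})$ with $a_{ij}\ne0$ iff $(i,j)\in E(G)$. $N^+_G[v]=\{u:(v,u)\in E(G)\}$ (out-neighbours, including $v$ itself if $v$ has a loop) and $N^-_G[v]=\{w:(w,v)\in E(G)\}$ (in-neighbours). $\circ$ denotes the entrywise (Hadamard) product. -}

module Defs where

open import Level using (Level; _⊔_) renaming (suc to lsuc)
open import Algebra.Bundles using (CommutativeRing)
open import Data.Nat using (ℕ)
open import Data.Fin using (Fin; _≟_)
open import Data.Bool using (Bool; true; _∨_; _∧_)
open import Data.Product using (_×_; ∃)
open import Relation.Nullary using (¬_)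
open import Relation.Nullary.Decidable using (⌊_⌋)
open import Relation.Binary.PropositionalEquality using (_≡_)
open import Relation.Unary using (Pred)
import Algebra.Properties.Monoid.Sum as MonoidSum

record Field (c ℓ : Level) : Set (lsuc (c ⊔ ℓ)) where
  field
    commutativeRing : CommutativeRing c ℓ
  open CommutativeRing commutativeRing public
  field
    1≉0     : ¬ (1# ≈ 0#)
    inverse : ∀ x → ¬ (x ≈ 0#) → ∃ λ y → x * y ≈ 1#

-- Digraphs on vertex set [n] = Fin n: the arc set E(G) ⊆ [n] × [n]
-- given by its (decidable) characteristic function. Loops allowed.
Digraph : ℕ → Set
Digraph n = Fin n → Fin n → Bool

Arc : ∀ {n} → Digraph n → Fin n → Fin n → Set
Arc G u v = G u v ≡ true

N⁺ : ∀ {n} → Digraph n → Fin n → Pred (Fin n) Level.zero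
N⁺ G v u = Arc G v u

N⁻ : ∀ {n} → Digraph n → Fin n → Pred (Fin n) Level.zero
N⁻ G v w = Arc G w v

addArc : ∀ {n} → Digraph n → Fin n → Fin n → Digraph n
addArc G a b u v = G u v ∨ (⌊ u ≟ a ⌋ ∧ ⌊ v ≟ b ⌋)

module FieldMatrices {c ℓ : Level} (F : Field c ℓ) where
  open Field F
  open MonoidSum +-monoid using (sum)

  Matrix : ℕ → Set c
  Matrix n = Fin n → Fin n → Carrier

  InM : ∀ {n} → Digraph n → Matrix n → Set ℓ
  InM G A = ∀ i j → (¬ (A i j ≈ 0#) → Arc G i j) × (Arc G i j → ¬ (A i j ≈ 0#))

  O : ∀ {n} → Matrix n
  O i j = 0#

  _ᵀ : ∀ {n} → Matrix n → Matrix n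
  (A ᵀ) i j = A j i

  _·_ : ∀ {n} → Matrix n → Matrix n → Matrix n
  (A · B) i j = sum (λ k → A i k * B k j)

  _⊖_ : ∀ {n} → Matrix n → Matrix n → Matrix n
  (A ⊖ B) i j = A i j - B i j

  _∘ₕ_ : ∀ {n} → Matrix n → Matrix n → Matrix n
  (A ∘ₕ B) i j = A i j * B i j

  _≋_ : ∀ {n} → Matrix n → Matrix n → Set ℓ
  A ≋ B = ∀ i j → A i j ≈ B i j

-- Comparing the (i , j) entries of A Xᵀ and Xᵀ A gives
--   Σₜ a_it x_jt = Σₜ x_ti a_tj.
-- Since X vanishes on the arcs of Gℓ and A off the arcs of G, the
-- t-th term on the left can only survive for t ∈ N⁺_G[i] ∖ N⁺_Gℓ[j], and on the
-- right only for t ∈ N⁻_G[j] ∖ N⁻_Gℓ[i]. Under (A) the identity reduces to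
-- a_ik x_jk = 0 with a_ik ≠ 0, under (B) to x_mi a_mj = 0 with a_mj ≠ 0; either
-- way X also vanishes on the new arc, which is all that X ∘ A_{ℓ+1} = O asks.
module Submission where

open import Level using (_⊔_)
open import Defs
open import Data.Nat using (ℕ; suc)
open import Data.Fin using (Fin; _≟_; punchIn)
open import Data.Fin.Properties using (punchInᵢ≢i)
open import Data.Bool using (Bool; true; false; if_then_else_)
import Data.Bool.Properties as Bool
open import Data.Product using (_×_; _,_; proj₁; proj₂)
open import Relation.Nullary using (¬_; Dec; yes; no; contradiction)
open import Relation.Nullary.Decidable using (⌊_⌋; _×-dec_)
import Relation.Binary.PropositionalEquality as ≡
open ≡ using (_≡_; _≢_; subst)
open import Relation.Unary using (_∉_; _∩_; ∁; _≐_; ∅; ｛_｝)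
import Algebra.Properties.CommutativeMonoid.Sum as CommutativeMonoidSum
import Algebra.Properties.Group as GroupProperties
import Relation.Binary.Reasoning.Setoid as SetoidReasoning

Arc? : ∀ {n} (H : Digraph n) u v → Dec (Arc H u v)
Arc? H u v = H u v Bool.≟ true

Arc-addArc⁺ : ∀ {n} (H : Digraph n) {a b u v} → Arc H u v → Arc (addArc H a b) u v
Arc-addArc⁺ H arc rewrite arc = ≡.refl

Arc-addArc⁻ : ∀ {n} (H : Digraph n) {a b u v} →
              Arc (addArc H a b) u v → ¬ (u ≡ a × v ≡ b) → Arc H u v
Arc-addArc⁻ H {a} {b} {u} {v} arc u,v≢a,b with H u v | u ≟ a | v ≟ b
... | true  | _       | _       = ≡.refl
... | false | yes u≡a | yes v≡b = contradiction (u≡a , v≡b) u,v≢a,b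
... | false | yes _   | no _    = arc
... | false | no _    | _       = arc

module _ {c ℓ} (F : Field c ℓ) where
  open Field F
  open FieldMatrices F
  open CommutativeMonoidSum +-commutativeMonoid using (sum; sum-cong-≋; sum-replicate-zero; sum-remove)
  open GroupProperties +-group using (x∙y⁻¹≈ε⇒x≈y)
  open SetoidReasoning setoid

  *-cancelˡ-≈0 : ∀ {a x} → ¬ a ≈ 0# → a * x ≈ 0# → x ≈ 0#
  *-cancelˡ-≈0 {a} {x} a≉0 ax≈0 with inverse a a≉0
  ... | a⁻¹ , aa⁻¹≈1 = begin
    x              ≈⟨ sym (*-identityˡ x) ⟩
    1# * x         ≈⟨ *-congʳ (sym aa⁻¹≈1) ⟩
    (a * a⁻¹) * x  ≈⟨ *-congʳ (*-comm a a⁻¹) ⟩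
    (a⁻¹ * a) * x  ≈⟨ *-assoc a⁻¹ a x ⟩
    a⁻¹ * (a * x)  ≈⟨ *-congˡ ax≈0 ⟩
    a⁻¹ * 0#       ≈⟨ zeroʳ a⁻¹ ⟩
    0#             ∎

  *-cancelʳ-≈0 : ∀ {a x} → ¬ a ≈ 0# → x * a ≈ 0# → x ≈ 0#
  *-cancelʳ-≈0 a≉0 xa≈0 = *-cancelˡ-≈0 a≉0 (trans (*-comm _ _) xa≈0)

  sum-≈0 : ∀ {n} (f : Fin n → Carrier) → (∀ t → f t ≈ 0#) → sum f ≈ 0#
  sum-≈0 {n} f f≈0 = trans (sum-cong-≋ f≈0) (sum-replicate-zero n)

  sum-≈single : ∀ {n} (f : Fin n → Carrier) k → (∀ t → t ≢ k → f t ≈ 0#) → sum f ≈ f k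
  sum-≈single {suc n} f k f≈0 = begin
    sum f                              ≈⟨ sum-remove f ⟩
    f k + sum (λ t → f (punchIn k t))  ≈⟨ +-congˡ (sum-≈0 _ (λ t → f≈0 _ (punchInᵢ≢i k t))) ⟩
    f k + 0#                           ≈⟨ +-identityʳ (f k) ⟩
    f k                                ∎

  InPattern : ∀ {n} → Digraph n → Fin n → Fin n → Carrier → Set ℓ
  InPattern H u v b = (¬ b ≈ 0# → Arc H u v) × (Arc H u v → ¬ b ≈ 0#)

  InPattern-nonArc : ∀ {n} {G H : Digraph n} {i t u v b} →
                     ¬ Arc G i t → ¬ Arc H u v → InPattern G i t b → InPattern H u v b
  InPattern-nonArc ¬Git ¬Huv (b≉0⇒Git , _) =
    (λ b≉0 → contradiction (b≉0⇒Git b≉0) ¬Git) , (λ Huv → contradiction Huv ¬Huv)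

  Annihilates : ∀ {n} → Digraph n → Matrix n → Set (c ⊔ ℓ)
  Annihilates H X = ∀ B → InM H B → (B ∘ₕ X) ≋ O

  indicator : Bool → Carrier
  indicator true  = 1#
  indicator false = 0#

  indicator-InPattern : ∀ {n} (H : Digraph n) u v → InPattern H u v (indicator (H u v))
  indicator-InPattern H u v with H u v
  ... | true  = (λ _ → ≡.refl) , (λ _ → 1≉0)
  ... | false = (λ 0≉0 → contradiction refl 0≉0) , (λ ())

  -- Testing Annihilates H X against this matrix yields b * X u v ≈ 0# for any b
  -- fitting the pattern at (u , v), although b ≈ 0# itself is undecidable.
  withEntry : ∀ {n} → Digraph n → Fin n → Fin n → Carrier → Matrix n
  withEntry H u v b u′ v′ = if ⌊ (u′ ≟ u) ×-dec (v′ ≟ v) ⌋ then b else indicator (H u′ v′)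

  withEntry-InM : ∀ {n} (H : Digraph n) {u v b} → InPattern H u v b → InM H (withEntry H u v b)
  withEntry-InM H {u} {v} b∈ u′ v′ with (u′ ≟ u) ×-dec (v′ ≟ v)
  ... | yes (≡.refl , ≡.refl) = b∈
  ... | no _                  = indicator-InPattern H u′ v′

  withEntry-diag : ∀ {n} (H : Digraph n) u v b → withEntry H u v b u v ≡ b
  withEntry-diag H u v b with (u ≟ u) ×-dec (v ≟ v)
  ... | yes _   = ≡.refl
  ... | no u,v≢ = contradiction (≡.refl , ≡.refl) u,v≢

  module _ {n} {H : Digraph n} {X : Matrix n} (H⊥X : Annihilates H X) where

    annihilates-entry : ∀ {u v b} → InPattern H u v b → b * X u v ≈ 0#
    annihilates-entry {u} {v} {b} b∈ =
      subst (λ b′ → b′ * X u v ≈ 0#) (withEntry-diag H u v b) (H⊥X _ (withEntry-InM H b∈) u v)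

    annihilates-arc : ∀ {u v} → Arc H u v → X u v ≈ 0#
    annihilates-arc arc = trans (sym (*-identityˡ _)) (annihilates-entry ((λ _ → arc) , (λ _ → 1≉0)))

    annihilates-addArc : ∀ {a b} → X a b ≈ 0# → ∀ B → InM (addArc H a b) B → (X ∘ₕ B) ≋ O
    annihilates-addArc {a} {b} Xab≈0 B B∈ u v with (u ≟ a) ×-dec (v ≟ b)
    ... | yes (≡.refl , ≡.refl) = trans (*-congʳ Xab≈0) (zeroˡ (B a b))
    ... | no u,v≢a,b            = trans (*-comm _ _) (annihilates-entry Buv∈)
      where
      Buv∈ : InPattern H u v (B u v)
      Buv∈ = (λ Buv≉0 → Arc-addArc⁻ H (proj₁ (B∈ u v) Buv≉0) u,v≢a,b)
           , (λ Huv → proj₂ (B∈ u v) (Arc-addArc⁺ H Huv))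

  module _ {n} {G Gℓ : Digraph n} {A X : Matrix n} (A∈ : InM G A) (Gℓ⊥X : Annihilates Gℓ X) where

    entry-product-≈0 : ∀ {p q r s} → ¬ (Arc G p q × ¬ Arc Gℓ r s) → A p q * X r s ≈ 0#
    entry-product-≈0 {p} {q} {r} {s} ¬surviving with Arc? Gℓ r s | Arc? G p q
    ... | yes Gℓrs | _       = trans (*-congˡ (annihilates-arc Gℓ⊥X Gℓrs)) (zeroʳ (A p q))
    ... | no ¬Gℓrs | yes Gpq = contradiction (Gpq , ¬Gℓrs) ¬surviving
    ... | no ¬Gℓrs | no ¬Gpq =
      annihilates-entry Gℓ⊥X (InPattern-nonArc {G = G} {H = Gℓ} ¬Gpq ¬Gℓrs (A∈ p q))

    row-term-≈0 : ∀ {i j t} → t ∉ (N⁺ G i ∩ ∁ (N⁺ Gℓ j)) → A i t * X j t ≈ 0#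
    row-term-≈0 = entry-product-≈0

    column-term-≈0 : ∀ {i j t} → t ∉ (N⁻ G j ∩ ∁ (N⁻ Gℓ i)) → X t i * A t j ≈ 0#
    column-term-≈0 t∉ = trans (*-comm _ _) (entry-product-≈0 t∉)

    module _ (AXᵀ≈XᵀA : ((A · (X ᵀ)) ⊖ ((X ᵀ) · A)) ≋ O) where

      row≈column : ∀ i j → sum (λ t → A i t * X j t) ≈ sum (λ t → X t i * A t j)
      row≈column i j = x∙y⁻¹≈ε⇒x≈y _ _ (AXᵀ≈XᵀA i j)

      new-arc-out : ∀ {i j k} →
                    (N⁺ G i ∩ ∁ (N⁺ Gℓ j)) ≐ ｛ k ｝ → (N⁻ G j ∩ ∁ (N⁻ Gℓ i)) ≐ ∅ → X j k ≈ 0#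
      new-arc-out {i} {j} {k} out≐k in≐∅ = *-cancelˡ-≈0 (proj₂ (A∈ i k) Gik) (begin
        A i k * X j k              ≈⟨ sum-≈single _ k row-off-k ⟨
        sum (λ t → A i t * X j t)  ≈⟨ row≈column i j ⟩
        sum (λ t → X t i * A t j)  ≈⟨ sum-≈0 _ (λ t → column-term-≈0 {t = t} (proj₁ in≐∅)) ⟩
        0#                         ∎)
        where
        Gik : Arc G i k
        Gik = proj₁ (proj₂ out≐k ≡.refl)
        row-off-k : ∀ t → t ≢ k → A i t * X j t ≈ 0#
        row-off-k t t≢k = row-term-≈0 (λ t∈ → t≢k (≡.sym (proj₁ out≐k t∈)))

      new-arc-in : ∀ {i j m} →
                   (N⁺ G i ∩ ∁ (N⁺ Gℓ j)) ≐ ∅ → (N⁻ G j ∩ ∁ (N⁻ Gℓ i)) ≐ ｛ m ｝ → X m i ≈ 0#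
      new-arc-in {i} {j} {m} out≐∅ in≐m = *-cancelʳ-≈0 (proj₂ (A∈ m j) Gmj) (begin
        X m i * A m j              ≈⟨ sum-≈single _ m column-off-m ⟨
        sum (λ t → X t i * A t j)  ≈⟨ row≈column i j ⟨
        sum (λ t → A i t * X j t)  ≈⟨ sum-≈0 _ (λ t → row-term-≈0 {t = t} (proj₁ out≐∅)) ⟩
        0#                         ∎)
        where
        Gmj : Arc G m j
        Gmj = proj₁ (proj₂ in≐m ≡.refl)
        column-off-m : ∀ t → t ≢ m → X t i * A t j ≈ 0#
        column-off-m t t≢m = column-term-≈0 (λ t∈ → t≢m (≡.sym (proj₁ in≐m t∈)))

lemma3p1 : ∀ {c ℓ} (F : Field c ℓ) → let open FieldMatrices F in
    (n : ℕ) (G Gℓ : Digraph n) →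
    (∀ u v → Arc G u v → Arc Gℓ u v) →
    (A X : Matrix n) → InM G A →
    ((A · (X ᵀ)) ⊖ ((X ᵀ) · A)) ≋ O →
    (∀ Aℓ → InM Gℓ Aℓ → (Aℓ ∘ₕ X) ≋ O) →
    (∀ (i j k : Fin n) →
       (N⁺ G i ∩ ∁ (N⁺ Gℓ j)) ≐ ｛ k ｝ →
       (N⁻ G j ∩ ∁ (N⁻ Gℓ i)) ≐ ∅ →
       ∀ Aℓ₊₁ → InM (addArc Gℓ j k) Aℓ₊₁ → (X ∘ₕ Aℓ₊₁) ≋ O)
    ×
    (∀ (i j m : Fin n) →
       (N⁺ G i ∩ ∁ (N⁺ Gℓ j)) ≐ ∅ →
       (N⁻ G j ∩ ∁ (N⁻ Gℓ i)) ≐ ｛ m ｝ →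
       ∀ Aℓ₊₁ → InM (addArc Gℓ m i) Aℓ₊₁ → (X ∘ₕ Aℓ₊₁) ≋ O)
lemma3p1 F n G Gℓ _ A X A∈ AXᵀ≈XᵀA Gℓ⊥X =
    (λ i j k out≐k in≐∅ → annihilates-addArc F Gℓ⊥X (new-arc-out F A∈ Gℓ⊥X AXᵀ≈XᵀA out≐k in≐∅))
  , (λ i j m out≐∅ in≐m → annihilates-addArc F Gℓ⊥X (new-arc-in F A∈ Gℓ⊥X AXᵀ≈XᵀA out≐∅ in≐m))
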